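{- Let $\kappa \geq 2$ be an integer and let $L_1, L_2, \ldots, L_{\kappa-1}$ be $\kappa - 1$ Latin squares of order $\kappa$ on the symbol set $\{1,\ldots,\kappa\}$ which are pairwise projective (i.e. $L_a$ and $L_b$ are projective for all $a \neq b$). Then there exists a projective plane of order $\kappa$.
   Context: A Latin square of order $\kappa$ is a $\kappa\times\kappa$ array with entries in $\{1,\ldots,\kappa\}$ in which every symbol occurs exactly once in each row and exactly once in each column. Two Latin squares $L = [l_{ij}]$ and $L' = [l'_{ij}]$ of order $\kappa$ are called projective if all diagonal entries of both are equal to $1$, and for every row index $r$ of $L$ and every row index $s$ of $L'$ there is exactly one column index $c$ with $l_{rc} = l'_{sc}$. A geometry is a pair $(\mathcal{P},\mathcal{L})$ of sets (with $\mathcal{P}\cap\mathcal{L}=\emptyset$), the elements of $\mathcal{L}$ (lines) being subsets of $\mathcal{P}$ (points), such that any two distinct points lie in exactly one common line and every line contains at least two points. A projective plane is a finite geometry in which any two distinct lines intersect and which has at least four points no three of which lie on a common line. Its order $\kappa$ is the number of points on a line minus one. -}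

module Defs where

open import Data.Nat using (ℕ; suc; _≥_)
open import Data.Fin using (Fin; toℕ)
open import Data.Fin.Subset using (Subset; _∈_; ∣_∣)
open import Data.Product using (Σ; ∃; ∃!; _×_; _,_)
open import Relation.Binary.PropositionalEquality using (_≡_; _≢_)
open import Relation.Nullary using (¬_)
open import Function.Definitions using (Injective)

-- A κ×κ array with entries in Fin κ (symbol s ∈ {1..κ} is represented by the Fin with toℕ = s-1).
Array : ℕ → Set
Array κ = Fin κ → Fin κ → Fin κ

record IsLatinSquare {κ : ℕ} (L : Array κ) : Set where
  field
    row-once : ∀ (r s : Fin κ) → ∃! _≡_ (λ c → L r c ≡ s)
    col-once : ∀ (c s : Fin κ) → ∃! _≡_ (λ r → L r c ≡ s)

record LatinSquare (κ : ℕ) : Set where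
  field
    entry   : Array κ
    isLatin : IsLatinSquare entry

open LatinSquare public

record Projective {κ : ℕ} (L L′ : LatinSquare κ) : Set where
  field
    diag₁ : ∀ i → toℕ (entry L i i) ≡ 0
    diag₂ : ∀ i → toℕ (entry L′ i i) ≡ 0
    unique-agree : ∀ (r s : Fin κ) → ∃! _≡_ (λ c → entry L r c ≡ entry L′ s c)

record FiniteGeometry : Set where
  field
    nP nL : ℕ
    line     : Fin nL → Subset nP
    line-inj : Injective _≡_ _≡_ line
    line-≥2  : ∀ l → ∣ line l ∣ ≥ 2
    join     : ∀ (p q : Fin nP) → p ≢ q →
               ∃! _≡_ (λ l → p ∈ line l × q ∈ line l)

Collinear₃ : (G : FiniteGeometry) → let open FiniteGeometry G in
             Fin nP → Fin nP → Fin nP → Set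
Collinear₃ G p q r = ∃ λ l → p ∈ line l × q ∈ line l × r ∈ line l
  where open FiniteGeometry G

record ProjectivePlane (κ : ℕ) : Set where
  field
    geometry : FiniteGeometry
  open FiniteGeometry geometry
  field
    meet  : ∀ (l m : Fin nL) → l ≢ m → ∃ λ p → p ∈ line l × p ∈ line m
    quad  : Σ (Fin 4 → Fin nP) λ f → Injective _≡_ _≡_ f ×
              (∀ i j k → i ≢ j → j ≢ k → i ≢ k →
                 ¬ Collinear₃ geometry (f i) (f j) (f k))
    order : ∀ l → ∣ line l ∣ ≡ suc κ

module Submission where

-- Call a family of κ arrays on a κ×κ grid a *slope system* when in every column each
-- symbol lies in exactly one row of each array, and two different arrays agree in
-- exactly one column along any choice of a row from each.  The κ - 1 Latin squares,
-- together with the "horizontal" array whose row i is constantly i, form a slope system.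
--
-- A slope system of order κ ≥ 2 yields a projective plane (the projective completion of
-- an affine plane): the points are the cells (c , y) of the grid together with κ + 1
-- ideal points, one per direction; the lines are the κ vertical lines, the graphs
-- c ↦ square d i c of the rows of each array d, and the line at infinity.  The heart of
-- the proof is the join of two cells in different columns: the κ arrays send the rows
-- through the first cell injectively to symbols in the column of the second cell, so
-- one of them hits it.

open import Defs
open import Data.Nat using (ℕ; zero; suc; _+_; _*_; _≥_; _∸_; s≤s; z≤n)
open import Data.Nat.Properties using (1+n≰n)
open import Data.Fin using (Fin; zero; suc; punchIn; punchOut)
open import Data.Fin.Patterns using (0F; 1F; 2F; 3F)
open import Data.Fin.Properties
  using (_≟_; any?; injective⇒≤; punchOut-injective; punchIn-punchOut; punchIn-injective;
         punchInᵢ≢i; suc-injective; +↔⊎; *↔×)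
open import Data.Fin.Subset using (Subset; _∈_; ∣_∣; inside; outside)
open import Data.Fin.Subset.Properties using (drop-there)
open import Data.Vec using (_∷_; []; here; there; tabulate)
open import Data.Vec.Properties using ([]=⇒lookup; lookup⇒[]=; lookup∘tabulate)
open import Data.Product using (∃; ∃₂; ∃!; _×_; _,_; proj₁; proj₂)
open import Data.Sum using (_⊎_; inj₁; inj₂)
open import Data.Sum.Function.Propositional using (_⊎-↔_)
open import Data.Unit using (⊤; tt)
open import Data.Empty using (⊥; ⊥-elim)
open import Data.Bool using (true)
open import Relation.Nullary using (¬_; Dec; yes; no; does; contradiction)
open import Relation.Nullary.Decidable using (dec-true)
open import Relation.Binary.PropositionalEquality
open import Function.Base using (_∘_)
open import Function.Bundles using (_↔_; _⇔_; mk⇔; Inverse; Injection; Equivalence)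
open import Function.Definitions using (Injective)
open import Function.Properties.Inverse using (↔-refl; ↔-sym; Inverse⇒Injection)
open import Function.Construct.Composition using (_↔-∘_)

-- An injective endomap of Fin k is onto: a missed value t would let it be squeezed
-- injectively into Fin (k - 1).
injective⇒surjective : ∀ {k} (f : Fin k → Fin k) → Injective _≡_ _≡_ f →
                       ∀ t → ∃ λ a → f a ≡ t
injective⇒surjective {zero} f f-inj ()
injective⇒surjective {suc k} f f-inj t with any? (λ a → f a ≟ t)
... | yes hit = hit
... | no miss = contradiction (injective⇒≤ squeeze-injective) 1+n≰n
  where
  avoids : ∀ a → t ≢ f a
  avoids a t≡fa = miss (a , sym t≡fa)

  squeeze : Fin (suc k) → Fin k
  squeeze a = punchOut (avoids a)

  squeeze-injective : Injective _≡_ _≡_ squeeze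
  squeeze-injective eq = f-inj (punchOut-injective (avoids _) (avoids _) eq)

three-in-two : ∀ {A : Set} {i j k u v : A} → i ≢ j → j ≢ k → i ≢ k →
               i ≡ u ⊎ i ≡ v → j ≡ u ⊎ j ≡ v → k ≡ u ⊎ k ≡ v → ⊥
three-in-two i≢j _   _   (inj₁ refl) (inj₁ refl) _           = i≢j refl
three-in-two i≢j _   _   (inj₂ refl) (inj₂ refl) _           = i≢j refl
three-in-two _   _   i≢k (inj₁ refl) (inj₂ refl) (inj₁ refl) = i≢k refl
three-in-two _   j≢k _   (inj₁ refl) (inj₂ refl) (inj₂ refl) = j≢k refl
three-in-two _   j≢k _   (inj₂ refl) (inj₁ refl) (inj₁ refl) = j≢k refl
three-in-two _   _   i≢k (inj₂ refl) (inj₁ refl) (inj₂ refl) = i≢k refl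

record Enumerates {k n : ℕ} (e : Fin k → Fin n) (s : Subset n) : Set where
  field
    injective : Injective _≡_ _≡_ e
    member    : ∀ j → e j ∈ s
    complete  : ∀ {x} → x ∈ s → ∃ λ j → e j ≡ x

module EnumerateTail {k n : ℕ} {s : Subset n} {e : Fin k → Fin (suc n)}
                     (enum : Enumerates e (outside ∷ s)) where
  open Enumerates enum

  nonzero : ∀ j → zero ≢ e j
  nonzero j 0≡ej with subst (_∈ outside ∷ s) (sym 0≡ej) (member j)
  ... | ()

  shifted : Fin k → Fin n
  shifted j = punchOut (nonzero j)

  suc-shifted : ∀ j → suc (shifted j) ≡ e j
  suc-shifted j = punchIn-punchOut (nonzero j)

  enumerates : Enumerates shifted s
  enumerates = record
    { injective = λ eq → injective (punchOut-injective (nonzero _) (nonzero _) eq)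
    ; member    = λ j → drop-there (subst (_∈ outside ∷ s) (sym (suc-shifted j)) (member j))
    ; complete  = λ x∈s → let j , ej≡x = complete (there x∈s) in
                          j , suc-injective (trans (suc-shifted j) ej≡x)
    }

module EnumerateRest {k n : ℕ} {s : Subset n} {e : Fin (suc k) → Fin (suc n)}
                     (enum : Enumerates e (inside ∷ s)) where
  open Enumerates enum

  j₀ : Fin (suc k)
  j₀ = proj₁ (complete here)

  ej₀≡0 : e j₀ ≡ zero
  ej₀≡0 = proj₂ (complete here)

  rest : Fin k → Fin (suc n)
  rest j = e (punchIn j₀ j)

  rest-nonzero : ∀ j {x} → rest j ≡ x → x ∈ inside ∷ s → x ∈ outside ∷ s
  rest-nonzero j {zero}  rj≡0 _ = ⊥-elim (punchInᵢ≢i j₀ j (injective (trans rj≡0 (sym ej₀≡0))))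
  rest-nonzero j {suc x} _ x∈  = there (drop-there x∈)

  enumerates : Enumerates rest (outside ∷ s)
  enumerates = record
    { injective = λ eq → punchIn-injective j₀ _ _ (injective eq)
    ; member    = λ j → rest-nonzero j refl (member (punchIn j₀ j))
    ; complete  = listed
    }
    where
    listed : ∀ {x} → x ∈ outside ∷ s → ∃ λ j → rest j ≡ x
    listed {suc x} (there x∈s) = punchOut j₀≢j , trans (cong e (punchIn-punchOut j₀≢j)) ej≡x
      where
      j = proj₁ (complete (there x∈s))
      ej≡x = proj₂ (complete (there x∈s))
      j₀≢j : j₀ ≢ j
      j₀≢j j₀≡j with trans (sym ej₀≡0) (trans (cong e j₀≡j) ej≡x)
      ... | ()

enumeration-size : ∀ {k n} {s : Subset n} {e : Fin k → Fin n} → Enumerates e s → ∣ s ∣ ≡ k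
enumeration-size {zero}  {s = []} _ = refl
enumeration-size {suc k} {s = []} {e} _ with e zero
... | ()
enumeration-size {s = outside ∷ s} enum = enumeration-size (EnumerateTail.enumerates enum)
enumeration-size {zero} {s = inside ∷ s} enum with Enumerates.complete enum here
... | () , _
enumeration-size {suc k} {s = inside ∷ s} enum =
  cong suc (enumeration-size (EnumerateRest.enumerates enum))

does⇒ : ∀ {A : Set} (a? : Dec A) → does a? ≡ true → A
does⇒ (yes a) _ = a

∈-tabulate : ∀ {n} {P : Fin n → Set} (P? : ∀ x → Dec (P x)) {x} →
             x ∈ tabulate (λ y → does (P? y)) ⇔ P x
∈-tabulate P? {x} = mk⇔
  (λ x∈ → does⇒ (P? x) (trans (sym (lookup∘tabulate _ x)) ([]=⇒lookup x∈)))
  (λ px → lookup⇒[]= x _ (trans (lookup∘tabulate _ x) (dec-true (P? x) px)))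

∃!-flip : ∀ {A B : Set} {f : A → B} {y : B} →
          ∃! _≡_ (λ x → f x ≡ y) → ∃! _≡_ (λ x → y ≡ f x)
∃!-flip (x , fx≡y , unique) = x , sym fx≡y , λ y≡fx′ → unique (sym y≡fx′)

record IncidencePlane (m : ℕ) : Set₁ where
  infix 4 _on_
  field
    Point Line : Set
    nP nL      : ℕ
    points     : Fin nP ↔ Point
    lines      : Fin nL ↔ Line
    _on_       : Point → Line → Set
    _on?_      : ∀ p l → Dec (p on l)
    join        : ∀ {p q} → p ≢ q → ∃ λ l → p on l × q on l
    join-unique : ∀ {p q l l′} → p ≢ q → p on l → q on l → p on l′ → q on l′ → l ≡ l′
    meet        : ∀ {l l′} → l ≢ l′ → ∃ λ p → p on l × p on l′
    pointOf           : Line → Fin (suc (suc m)) → Point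
    pointOf-injective : ∀ l → Injective _≡_ _≡_ (pointOf l)
    pointOf-on        : ∀ l j → pointOf l j on l
    pointOf-complete  : ∀ {p l} → p on l → ∃ λ j → pointOf l j ≡ p
    quadrangle           : Fin 4 → Point
    quadrangle-injective : Injective _≡_ _≡_ quadrangle
    quadrangle-two       : ∀ l → ∃₂ λ u v → ∀ i → quadrangle i on l → i ≡ u ⊎ i ≡ v

module Realisation {m : ℕ} (Π : IncidencePlane m) where
  open IncidencePlane Π

  open Inverse points using () renaming
    (to to point; from to index; strictlyInverseˡ to point-index;
     strictlyInverseʳ to index-point)
  open Inverse lines using () renaming
    (to to lineAt; from to lineIndex; strictlyInverseˡ to lineAt-lineIndex;
     strictlyInverseʳ to lineIndex-lineAt)

  point-injective : Injective _≡_ _≡_ point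
  point-injective = Injection.injective (Inverse⇒Injection points)

  index-injective : Injective _≡_ _≡_ index
  index-injective = Injection.injective (Inverse⇒Injection (↔-sym points))

  lineAt-injective : Injective _≡_ _≡_ lineAt
  lineAt-injective = Injection.injective (Inverse⇒Injection lines)

  lineSet : Fin nL → Subset nP
  lineSet ℓ = tabulate (λ x → does (point x on? lineAt ℓ))

  ∈-lineSet : ∀ {x ℓ} → x ∈ lineSet ℓ ⇔ point x on lineAt ℓ
  ∈-lineSet {ℓ = ℓ} = ∈-tabulate (λ x → point x on? lineAt ℓ)

  ∈⇒on : ∀ {p ℓ} → index p ∈ lineSet ℓ → p on lineAt ℓ
  ∈⇒on {p} x∈ = subst (_on _) (point-index p) (Equivalence.to ∈-lineSet x∈)

  on⇒∈ : ∀ {p ℓ} → p on lineAt ℓ → index p ∈ lineSet ℓ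
  on⇒∈ {p} p-on = Equivalence.from ∈-lineSet (subst (_on _) (sym (point-index p)) p-on)

  on⇒∈-index : ∀ {x l} → point x on l → x ∈ lineSet (lineIndex l)
  on⇒∈-index {l = l} x-on =
    Equivalence.from ∈-lineSet (subst (_ on_) (sym (lineAt-lineIndex l)) x-on)

  lineSet-size : ∀ ℓ → ∣ lineSet ℓ ∣ ≡ suc (suc m)
  lineSet-size ℓ = enumeration-size record
    { injective = λ eq → pointOf-injective (lineAt ℓ) (index-injective eq)
    ; member    = λ j → on⇒∈ (pointOf-on (lineAt ℓ) j)
    ; complete  = listed
    }
    where
    listed : ∀ {x} → x ∈ lineSet ℓ → ∃ λ j → index (pointOf (lineAt ℓ) j) ≡ x
    listed {x} x∈ =
      let j , pj≡x = pointOf-complete (Equivalence.to ∈-lineSet x∈)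
      in j , trans (cong index pj≡x) (index-point x)

  joinSets : ∀ x y → x ≢ y → ∃! _≡_ (λ ℓ → x ∈ lineSet ℓ × y ∈ lineSet ℓ)
  joinSets x y x≢y with join (x≢y ∘ point-injective)
  ... | l , x-on , y-on = lineIndex l , (on⇒∈-index x-on , on⇒∈-index y-on) , unique
    where
    unique : ∀ {ℓ} → x ∈ lineSet ℓ × y ∈ lineSet ℓ → lineIndex l ≡ ℓ
    unique {ℓ} (x∈ , y∈) = trans
      (cong lineIndex (join-unique (x≢y ∘ point-injective) x-on y-on
                         (Equivalence.to ∈-lineSet x∈) (Equivalence.to ∈-lineSet y∈)))
      (lineIndex-lineAt ℓ)

  -- A line is determined by two of its points, so by its point set.
  lineSet-injective : Injective _≡_ _≡_ lineSet
  lineSet-injective {ℓ} {ℓ′} same = lineAt-injective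
    (join-unique p₀≢p₁ (pointOf-on _ 0F) (pointOf-on _ 1F) (moved 0F) (moved 1F))
    where
    p : Fin (suc (suc m)) → Point
    p = pointOf (lineAt ℓ)

    p₀≢p₁ : p 0F ≢ p 1F
    p₀≢p₁ eq with pointOf-injective (lineAt ℓ) eq
    ... | ()

    moved : ∀ j → p j on lineAt ℓ′
    moved j = ∈⇒on (subst (index (p j) ∈_) same (on⇒∈ (pointOf-on _ j)))

  geometry : FiniteGeometry
  geometry = record
    { nP       = nP
    ; nL       = nL
    ; line     = lineSet
    ; line-inj = lineSet-injective
    ; line-≥2  = λ ℓ → subst (_≥ 2) (sym (lineSet-size ℓ)) (s≤s (s≤s z≤n))
    ; join     = joinSets
    }

  meetSets : ∀ ℓ ℓ′ → ℓ ≢ ℓ′ → ∃ λ x → x ∈ lineSet ℓ × x ∈ lineSet ℓ′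
  meetSets ℓ ℓ′ ℓ≢ℓ′ with meet (ℓ≢ℓ′ ∘ lineAt-injective)
  ... | p , p-on , p-on′ = index p , on⇒∈ p-on , on⇒∈ p-on′

  noThreeCollinear : ∀ i j k → i ≢ j → j ≢ k → i ≢ k →
                     ¬ Collinear₃ geometry (index (quadrangle i))
                                           (index (quadrangle j)) (index (quadrangle k))
  noThreeCollinear i j k i≢j j≢k i≢k (ℓ , i∈ , j∈ , k∈) =
    let u , v , two = quadrangle-two (lineAt ℓ)
    in three-in-two i≢j j≢k i≢k (two i (∈⇒on i∈)) (two j (∈⇒on j∈)) (two k (∈⇒on k∈))

  plane : ProjectivePlane (suc m)
  plane = record
    { geometry = geometry
    ; meet     = meetSets
    ; quad     = index ∘ quadrangle
               , (λ eq → quadrangle-injective (index-injective eq))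
               , noThreeCollinear
    ; order    = lineSet-size
    }

record SlopeSystem (κ : ℕ) : Set where
  field
    square        : Fin κ → Array κ
    column-unique : ∀ d c y → ∃! _≡_ (λ i → square d i c ≡ y)
    agree-unique  : ∀ {d d′} → d ≢ d′ → ∀ i i′ → ∃! _≡_ (λ c → square d i c ≡ square d′ i′ c)

-- Direction 0 is vertical, direction
-- suc d is that of slope d.
module ProjectiveCompletion {n : ℕ} (S : SlopeSystem (suc (suc n))) where
  open SlopeSystem S

  κ : ℕ
  κ = suc (suc n)

  row : Fin κ → Fin κ → Fin κ → Fin κ
  row d c y = proj₁ (column-unique d c y)

  row-hits : ∀ {d c y} → square d (row d c y) c ≡ y
  row-hits {d} {c} {y} = proj₁ (proj₂ (column-unique d c y))

  row-unique : ∀ {d c y i} → square d i c ≡ y → row d c y ≡ i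
  row-unique {d} {c} {y} = proj₂ (proj₂ (column-unique d c y))

  agree-once : ∀ {d d′ i i′ c c′} → d ≢ d′ → square d i c ≡ square d′ i′ c →
               square d i c′ ≡ square d′ i′ c′ → c ≡ c′
  agree-once {d} {d′} {i} {i′} d≢d′ at-c at-c′ =
    let _ , _ , unique = agree-unique d≢d′ i i′ in trans (sym (unique at-c)) (unique at-c′)

  -- Some slope has a row through (c , y) and (c′ , y′) when c ≢ c′: the κ slopes send
  -- their rows through (c , y) to κ pairwise different symbols in column c′.
  slope-through : ∀ {c c′} → c ≢ c′ → ∀ y y′ → ∃ λ d → square d (row d c y) c′ ≡ y′
  slope-through {c} {c′} c≢c′ y = injective⇒surjective image image-injective
    where
    image : Fin κ → Fin κ
    image d = square d (row d c y) c′

    image-injective : Injective _≡_ _≡_ image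
    image-injective {d} {d′} eq with d ≟ d′
    ... | yes d≡d′ = d≡d′
    ... | no d≢d′ = ⊥-elim (c≢c′ (agree-once d≢d′ (trans row-hits (sym row-hits)) eq))

  Point : Set
  Point = (Fin κ × Fin κ) ⊎ Fin (suc κ)

  pattern aff c y = inj₁ (c , y)
  pattern ideal e = inj₂ e

  Line : Set
  Line = (Fin (suc κ) × Fin κ) ⊎ Fin 1

  pattern affine e i = inj₁ (e , i)
  pattern atInfinity = inj₂ 0F

  points : Fin (κ * κ + suc κ) ↔ Point
  points = (*↔× ⊎-↔ ↔-refl) ↔-∘ +↔⊎

  lines : Fin (suc κ * κ + 1) ↔ Line
  lines = (*↔× ⊎-↔ ↔-refl) ↔-∘ +↔⊎

  infix 4 _on_
  _on_ : Point → Line → Set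
  aff c y on affine zero i    = c ≡ i
  aff c y on affine (suc d) i = square d i c ≡ y
  aff c y on atInfinity       = ⊥
  ideal e on affine e′ i      = e ≡ e′
  ideal e on atInfinity       = ⊤

  _on?_ : ∀ p l → Dec (p on l)
  aff c y on? affine zero i    = c ≟ i
  aff c y on? affine (suc d) i = square d i c ≟ y
  aff c y on? atInfinity       = no λ ()
  ideal e on? affine e′ i      = e ≟ e′
  ideal e on? atInfinity       = yes tt

  through : Fin (suc κ) → Fin κ → Fin κ → Fin κ
  through zero    c y = c
  through (suc d) c y = row d c y

  through-on : ∀ e c y → aff c y on affine e (through e c y)
  through-on zero    c y = refl
  through-on (suc d) c y = row-hits

  one-per-direction : ∀ e {c y i i′} → aff c y on affine e i → aff c y on affine e i′ → i ≡ i′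
  one-per-direction zero    c≡i c≡i′ = trans (sym c≡i) c≡i′
  one-per-direction (suc d) on-i on-i′ = trans (sym (row-unique on-i)) (row-unique on-i′)

  vertical-meets-once : ∀ {c y c′ y′ i d j} →
    aff c y on affine zero i → aff c′ y′ on affine zero i →
    aff c y on affine (suc d) j → aff c′ y′ on affine (suc d) j → (c , y) ≡ (c′ , y′)
  vertical-meets-once refl refl refl refl = refl

  slopes-meet-once : ∀ {c y c′ y′ d i d′ i′} → d ≢ d′ →
    aff c y on affine (suc d) i → aff c′ y′ on affine (suc d) i →
    aff c y on affine (suc d′) i′ → aff c′ y′ on affine (suc d′) i′ → (c , y) ≡ (c′ , y′)
  slopes-meet-once d≢d′ p-on q-on p-on′ q-on′
    with agree-once d≢d′ (trans p-on (sym p-on′)) (trans q-on (sym q-on′))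
  ... | refl = cong (_ ,_) (trans (sym p-on) q-on)

  direction-unique : ∀ {c y c′ y′ e i e′ i′} → (c , y) ≢ (c′ , y′) →
    aff c y on affine e i → aff c′ y′ on affine e i →
    aff c y on affine e′ i′ → aff c′ y′ on affine e′ i′ → e ≡ e′
  direction-unique {e = zero}  {e′ = zero}   _   _ _ _ _ = refl
  direction-unique {e = zero}  {e′ = suc _}  p≢q p-on q-on p-on′ q-on′ =
    ⊥-elim (p≢q (vertical-meets-once p-on q-on p-on′ q-on′))
  direction-unique {e = suc _} {e′ = zero}   p≢q p-on q-on p-on′ q-on′ =
    ⊥-elim (p≢q (vertical-meets-once p-on′ q-on′ p-on q-on))
  direction-unique {e = suc d} {e′ = suc d′} p≢q p-on q-on p-on′ q-on′ with d ≟ d′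
  ... | yes d≡d′ = cong suc d≡d′
  ... | no d≢d′ = ⊥-elim (p≢q (slopes-meet-once d≢d′ p-on q-on p-on′ q-on′))

  join : ∀ {p q} → p ≢ q → ∃ λ l → p on l × q on l
  join {aff c y} {aff c′ y′} _ with c ≟ c′
  ... | yes refl = affine zero c , refl , refl
  ... | no c≢c′ with slope-through c≢c′ y y′
  ...   | d , hit = affine (suc d) (row d c y) , row-hits , hit
  join {aff c y}  {ideal e}   _ = affine e (through e c y) , through-on e c y , refl
  join {ideal e}  {aff c y}   _ = affine e (through e c y) , refl , through-on e c y
  join {ideal e}  {ideal e′}  _ = atInfinity , tt , tt

  join-unique : ∀ {p q l l′} → p ≢ q → p on l → q on l → p on l′ → q on l′ → l ≡ l′
  join-unique {l = atInfinity} {atInfinity} _ _ _ _ _ = refl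
  join-unique {aff _ _} {l = atInfinity} _ () _ _ _
  join-unique {aff _ _} {l′ = atInfinity} _ _ _ () _
  join-unique {ideal _} {aff _ _} {atInfinity} _ _ () _ _
  join-unique {ideal _} {aff _ _} {l′ = atInfinity} _ _ _ _ ()
  join-unique {ideal _} {ideal _} {atInfinity} {affine _ _} p≢q _ _ refl refl = ⊥-elim (p≢q refl)
  join-unique {ideal _} {ideal _} {affine _ _} {atInfinity} p≢q refl refl _ _ = ⊥-elim (p≢q refl)
  join-unique {ideal _} {ideal _} {affine _ _} {affine _ _} p≢q refl refl _ _ = ⊥-elim (p≢q refl)
  join-unique {ideal _} {aff _ _} {affine e _} {affine _ _} _ refl q-on refl q-on′ =
    cong (affine e) (one-per-direction e q-on q-on′)
  join-unique {aff _ _} {ideal _} {affine e _} {affine _ _} _ p-on refl p-on′ refl =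
    cong (affine e) (one-per-direction e p-on p-on′)
  join-unique {aff _ _} {aff _ _} {affine e _} {affine _ _} p≢q p-on q-on p-on′ q-on′
    with direction-unique (p≢q ∘ cong inj₁) p-on q-on p-on′ q-on′
  ... | refl = cong (affine e) (one-per-direction e p-on p-on′)

  crossing : ∀ {e e′} → e ≢ e′ → ∀ i i′ → ∃ λ p → p on affine e i × p on affine e′ i′
  crossing {zero}  {zero}   e≢e′ _ _  = ⊥-elim (e≢e′ refl)
  crossing {zero}  {suc d′} _    c i′ = aff c (square d′ i′ c) , refl , refl
  crossing {suc d} {zero}   _    i c  = aff c (square d i c) , refl , refl
  crossing {suc d} {suc d′} e≢e′ i i′ with agree-unique (e≢e′ ∘ cong suc) i i′
  ... | c , agree , _ = aff c (square d i c) , refl , sym agree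

  meet : ∀ {l l′} → l ≢ l′ → ∃ λ p → p on l × p on l′
  meet {atInfinity}   {atInfinity}    l≢l′ = ⊥-elim (l≢l′ refl)
  meet {affine e _}   {atInfinity}    _    = ideal e , refl , tt
  meet {atInfinity}   {affine e _}    _    = ideal e , tt , refl
  meet {affine e i}   {affine e′ i′}  l≢l′ with e ≟ e′
  ... | yes e≡e′ = ideal e , refl , e≡e′
  ... | no e≢e′  = crossing e≢e′ i i′

  pointOf : Line → Fin (suc κ) → Point
  pointOf (affine e i)       zero    = ideal e
  pointOf (affine zero i)    (suc y) = aff i y
  pointOf (affine (suc d) i) (suc c) = aff c (square d i c)
  pointOf atInfinity         e       = ideal e

  pointOf-injective : ∀ l → Injective _≡_ _≡_ (pointOf l)
  pointOf-injective (affine _ _)       {zero}  {zero}  _    = refl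
  pointOf-injective (affine zero _)    {suc _} {suc _} refl = refl
  pointOf-injective (affine (suc _) _) {suc _} {suc _} refl = refl
  pointOf-injective (affine zero _)    {zero}  {suc _} ()
  pointOf-injective (affine (suc _) _) {zero}  {suc _} ()
  pointOf-injective (affine zero _)    {suc _} {zero}  ()
  pointOf-injective (affine (suc _) _) {suc _} {zero}  ()
  pointOf-injective atInfinity                         refl = refl

  pointOf-on : ∀ l j → pointOf l j on l
  pointOf-on (affine e i)       zero    = refl
  pointOf-on (affine zero i)    (suc y) = refl
  pointOf-on (affine (suc d) i) (suc c) = refl
  pointOf-on atInfinity         e       = tt

  pointOf-complete : ∀ {p l} → p on l → ∃ λ j → pointOf l j ≡ p
  pointOf-complete {aff c y} {affine zero i}    refl = suc y , refl
  pointOf-complete {aff c y} {affine (suc d) i} on   = suc c , cong (aff c) on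
  pointOf-complete {ideal e} {affine e′ i}      refl = zero , refl
  pointOf-complete {ideal e} {atInfinity}       tt   = e , refl
  pointOf-complete {aff _ _} {atInfinity}       ()

  -- The quadrangle: the origin, a cell of column 1 off the row of slope 0 through the
  -- origin, and the ideal points of the vertical direction and of slope 0.
  origin : Point
  origin = aff 0F 0F

  offRow : Point
  offRow = aff 1F (punchIn (square 0F (row 0F 0F 0F) 1F) 0F)

  offRow-off : ∀ {i} → origin on affine 1F i → offRow on affine 1F i → ⊥
  offRow-off origin-on offRow-on with row-unique origin-on
  ... | refl = punchInᵢ≢i _ 0F (sym offRow-on)

  quadrangle : Fin 4 → Point
  quadrangle 0F = origin
  quadrangle 1F = offRow
  quadrangle 2F = ideal 0F
  quadrangle 3F = ideal 1F

  corner : Point → Fin 4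
  corner (aff zero _)    = 0F
  corner (aff (suc _) _) = 1F
  corner (ideal zero)    = 2F
  corner (ideal (suc _)) = 3F

  corner-quadrangle : ∀ i → corner (quadrangle i) ≡ i
  corner-quadrangle 0F = refl
  corner-quadrangle 1F = refl
  corner-quadrangle 2F = refl
  corner-quadrangle 3F = refl

  quadrangle-injective : Injective _≡_ _≡_ quadrangle
  quadrangle-injective {i} {j} eq =
    trans (sym (corner-quadrangle i)) (trans (cong corner eq) (corner-quadrangle j))

  quadrangle-two : ∀ l → ∃₂ λ u v → ∀ i → quadrangle i on l → i ≡ u ⊎ i ≡ v
  quadrangle-two (affine 0F 0F) =
    0F , 2F , λ { 0F _ → inj₁ refl ; 2F _ → inj₂ refl ; 1F () ; 3F () }
  quadrangle-two (affine 0F (suc c)) =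
    1F , 2F , λ { 1F _ → inj₁ refl ; 2F _ → inj₂ refl ; 0F () ; 3F () }
  quadrangle-two (affine 1F i) with origin on? affine 1F i
  ... | yes origin-on = 0F , 3F , λ { 0F _ → inj₁ refl ; 3F _ → inj₂ refl
                                    ; 1F offRow-on → ⊥-elim (offRow-off origin-on offRow-on)
                                    ; 2F () }
  ... | no origin-off = 1F , 3F , λ { 1F _ → inj₁ refl ; 3F _ → inj₂ refl
                                    ; 0F origin-on → ⊥-elim (origin-off origin-on)
                                    ; 2F () }
  quadrangle-two (affine (suc (suc d)) i) =
    0F , 1F , λ { 0F _ → inj₁ refl ; 1F _ → inj₂ refl ; 2F () ; 3F () }
  quadrangle-two atInfinity =
    2F , 3F , λ { 2F _ → inj₁ refl ; 3F _ → inj₂ refl ; 0F () ; 1F () }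

  incidencePlane : IncidencePlane (suc n)
  incidencePlane = record
    { Point = Point ; Line = Line ; points = points ; lines = lines
    ; _on_ = _on_ ; _on?_ = _on?_
    ; join = join ; join-unique = join-unique ; meet = meet
    ; pointOf = pointOf ; pointOf-injective = pointOf-injective
    ; pointOf-on = pointOf-on ; pointOf-complete = pointOf-complete
    ; quadrangle = quadrangle ; quadrangle-injective = quadrangle-injective
    ; quadrangle-two = quadrangle-two
    }

latinSlopes : ∀ {n} (Ls : Fin (suc n) → LatinSquare (suc (suc n))) →
              (∀ a b → a ≢ b → Projective (Ls a) (Ls b)) → SlopeSystem (suc (suc n))
latinSlopes Ls projective = record
  { square        = square
  ; column-unique = column-unique
  ; agree-unique  = agree-unique
  }
  where
  square : Fin _ → Array _
  square zero    i c = i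
  square (suc a)     = entry (Ls a)

  column-unique : ∀ d c y → ∃! _≡_ (λ i → square d i c ≡ y)
  column-unique zero    c y = y , refl , sym
  column-unique (suc a)     = IsLatinSquare.col-once (isLatin (Ls a))

  agree-unique : ∀ {d d′} → d ≢ d′ → ∀ i i′ → ∃! _≡_ (λ c → square d i c ≡ square d′ i′ c)
  agree-unique {zero}  {zero}  d≢d′ _ _  = ⊥-elim (d≢d′ refl)
  agree-unique {zero}  {suc b} _    i i′ = ∃!-flip (IsLatinSquare.row-once (isLatin (Ls b)) i′ i)
  agree-unique {suc a} {zero}  _    i i′ = IsLatinSquare.row-once (isLatin (Ls a)) i i′
  agree-unique {suc a} {suc b} d≢d′      =
    Projective.unique-agree (projective a b (d≢d′ ∘ cong suc))

theorem29 : (κ : ℕ) → κ ≥ 2 → (Ls : Fin (κ ∸ 1) → LatinSquare κ) →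
    (∀ a b → a ≢ b → Projective (Ls a) (Ls b)) → ProjectivePlane κ
theorem29 (suc (suc n)) (s≤s (s≤s z≤n)) Ls projective =
  Realisation.plane (ProjectiveCompletion.incidencePlane (latinSlopes Ls projective))
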